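{- Let $p$ be a prime and $a,b\in\mathbb Z$ with $a\not\equiv b\pmod p$. Then the matrices $M_1(a)$ and $M_1(b)$, with entries reduced modulo $p$, are qualified to construct a $(0,2)$-sequence over $\mathbb F_p$ in the sense of Niederreiter; that is, for every integer $m\ge1$ and all $d_1,d_2\in\mathbb N_0$ with $d_1+d_2=m$, the $m\times m$ matrix over $\mathbb F_p$ whose rows are the vectors $([M_1(a)]_{i,0},\dots,[M_1(a)]_{i,m-1})$ for $0\le i<d_1$ together with the vectors $([M_1(b)]_{i,0},\dots,[M_1(b)]_{i,m-1})$ for $0\le i<d_2$ (all reduced mod $p$) has full rank $m$.
   Context: For $n\in\mathbb N_0$ with binary representation $n=n_0+n_12+\cdots$ ($n_i\in\{0,1\}$), let $s_2(n)=n_0+n_1+\cdots$. For $a\in\mathbb Z\setminus\{0\}$ define the $\mathbb N_0\times\mathbb N_0$ integer matrix $M_1(a)=\big(\big(\binom{j}{i}\bmod 2\big)\,a^{s_2(j)-s_2(i)}\big)_{i,j\ge 0}$, where $\binom{j}{i}=0$ for $i>j$ and $\binom{j}{i}\bmod 2\in\{0,1\}$ is regarded as an integer; set $M_1(0)=(\delta_{i,j})_{i,j\ge 0}$ (identity matrix). $[C]_{i,j}$ denotes the entry of $C$ in row $i$, column $j$ (indices starting at $0$). -}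

module Defs where

open import Data.Nat as ℕ using (ℕ; zero; suc; _∸_)
open import Data.Nat.DivMod using (_%_; _/_)
open import Data.Nat.Combinatorics using (_C_)
open import Data.Integer as ℤ using (ℤ; +_; _*_; _+_; _^_)
open import Data.Integer.Divisibility using (_∣_)
open import Data.Fin using (Fin; toℕ)
open import Data.Bool using (if_then_else_)
open import Relation.Nullary.Decidable using (does)
import Data.Fin
import Data.Sum

s₂-fuel : ℕ → ℕ → ℕ
s₂-fuel zero    n = 0
s₂-fuel (suc f) zero = 0
s₂-fuel (suc f) n@(suc _) = n % 2 ℕ.+ s₂-fuel f (n / 2)

s₂ : ℕ → ℕ
s₂ n = s₂-fuel n n

-- binom(j,i) mod 2, as an integer in {0,1}  (_C_ is 0 for i > j)
binomMod2 : ℕ → ℕ → ℤ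
binomMod2 j i = + ((j C i) % 2)

-- entry [M₁(a)]_{i,j};  M₁(0) is the identity matrix.
-- (truncated ∸ is harmless: whenever binom(j,i) is odd, s₂(i) ≤ s₂(j))
M₁ : ℤ → ℕ → ℕ → ℤ
M₁ (+ zero) i j = if does (i ℕ.≟ j) then + 1 else + 0
M₁ a        i j = binomMod2 j i * (a ^ (s₂ j ∸ s₂ i))

Σ : (n : ℕ) → (Fin n → ℤ) → ℤ
Σ zero    f = + 0
Σ (suc n) f = f Fin.zero + Σ n (λ k → f (Fin.suc k))

_≡[mod_]_ : ℤ → ℕ → ℤ → Set
x ≡[mod p ] y = (+ p) ∣ (x ℤ.- y)

FullRankMod : (p m : ℕ) → (Fin m → Fin m → ℤ) → Set
FullRankMod p m R =
  (c : Fin m → ℤ) →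
  (∀ (col : Fin m) → Σ m (λ r → c r * R r col) ≡[mod p ] (+ 0)) →
  ∀ (r : Fin m) → c r ≡[mod p ] (+ 0)

stackedRows : ℤ → ℤ → (d₁ d₂ : ℕ) → Fin (d₁ ℕ.+ d₂) → Fin (d₁ ℕ.+ d₂) → ℤ
stackedRows a b d₁ d₂ r col with Data.Fin.splitAt d₁ r
... | Data.Sum.inj₁ i = M₁ a (toℕ i) (toℕ col)
... | Data.Sum.inj₂ i = M₁ b (toℕ i) (toℕ col)

module Submission where

-- M₁(a) and M₁(b) are the infinite Kronecker powers of (1 a; 0 1) and (1 b; 0 1), indexed by
-- binary digits: by Lucas' theorem binom(j, i) is odd iff the digits of i are among those of j,
-- and s₂(j) − s₂(i) then counts the digits of j missing from i. So if a combination of the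
-- first d₁ rows of M₁(a) and d₂ rows of M₁(b) vanishes mod p on the first d₁ + d₂ columns,
-- its even columns form such a combination of the even-indexed rows, and once those
-- coefficients are known to vanish, its odd columns form one of the odd-indexed rows; both
-- have about half the size, and we induct. Only when d₁ and d₂ are both odd are there more
-- even rows than even columns; then the odd columns minus b times the even ones leave the
-- factor a − b, a unit mod p, on the surplus row.

open import Data.Bool.Base using (Bool; false; if_then_else_)
open import Data.Fin.Base as Fin using (Fin; toℕ; fromℕ<; _↑ˡ_; _↑ʳ_)
import Data.Fin.Properties as Finₚ
open import Data.Integer.Base as ℤ using (ℤ; +_; -[1+_])
import Data.Integer.Properties as ℤₚ
open import Data.Integer.Divisibility.Signed
  using (_∣_; divides; ∣ᵤ⇒∣; ∣⇒∣ᵤ; ∣m∣n⇒∣m+n; ∣m∣n⇒∣m-n; ∣m+n∣m⇒∣n; ∣n⇒∣m*n; ∣m⇒∣m*n)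
open import Data.Integer.Tactic.RingSolver using (solve-∀)
open import Data.Nat.Base as ℕ using (ℕ; zero; suc; _≤_; _<_; z≤n; s≤s; _∸_; _≡ᵇ_; parity)
import Data.Nat.Properties as ℕₚ
open import Data.Nat.Combinatorics using (_C_; nCk+nC[k+1]≡[n+1]C[k+1])
open import Data.Nat.DivMod using (_%_; _/_; m/n<m; m/n≡1+[m∸n]/n)
import Data.Nat.Divisibility as ℕ∣
open import Data.Nat.Primality using (Prime; euclidsLemma)
open import Data.Parity.Base as ℙ using (0ℙ; 1ℙ)
import Data.Parity.Properties as ℙₚ
open import Data.Product.Base using (_×_; _,_; proj₁; proj₂; ∃₂)
open import Data.Sum.Base using (inj₁; inj₂)
open import Function.Base using (_∘_)
open import Relation.Binary.PropositionalEquality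
  using (_≡_; refl; sym; trans; cong; cong₂; subst; module ≡-Reasoning)
open import Relation.Nullary.Decidable using (does; dec-true; dec-false)
open import Relation.Nullary.Negation using (¬_; contradiction)

open import Defs

double : ℕ → ℕ
double zero    = zero
double (suc n) = suc (suc (double n))

double≡2* : ∀ n → double n ≡ 2 ℕ.* n
double≡2* zero    = refl
double≡2* (suc n) = trans (cong (suc ∘ suc) (double≡2* n)) (sym (ℕₚ.*-suc 2 n))

double-mono-≤ : ∀ {m n} → m ≤ n → double m ≤ double n
double-mono-≤ z≤n       = z≤n
double-mono-≤ (s≤s m≤n) = s≤s (s≤s (double-mono-≤ m≤n))

double-cancel-≤ : ∀ {m n} → double m ≤ double n → m ≤ n
double-cancel-≤ {zero}          _               = z≤n
double-cancel-≤ {suc m} {suc n} (s≤s (s≤s m≤n)) = s≤s (double-cancel-≤ m≤n)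

double-cancel-< : ∀ {m n} → double m < double n → m < n
double-cancel-< {zero}  {suc n} _               = s≤s z≤n
double-cancel-< {suc m} {suc n} (s≤s (s≤s m<n)) = s≤s (double-cancel-< m<n)

-- Halves n n⁰ n¹ : n⁰ = ⌈n/2⌉ and n¹ = ⌊n/2⌋ count the even and the odd numbers below n.
data Halves : ℕ → ℕ → ℕ → Set where
  even : ∀ k → Halves (double k) k k
  odd  : ∀ k → Halves (suc (double k)) (suc k) k

Halves-suc : ∀ {n n⁰ n¹} → Halves n n⁰ n¹ → Halves (suc n) (suc n¹) n⁰
Halves-suc (even k) = odd k
Halves-suc (odd k)  = even (suc k)

halves : ∀ n → ∃₂ (Halves n)
halves zero = _ , _ , even zero
halves (suc n) with halves n
... | _ , _ , h = _ , _ , Halves-suc h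

Halves-double-+ : ∀ k {n n⁰ n¹} → Halves n n⁰ n¹ → Halves (double k ℕ.+ n) (k ℕ.+ n⁰) (k ℕ.+ n¹)
Halves-double-+ zero    h = h
Halves-double-+ (suc k) h = Halves-suc (Halves-suc (Halves-double-+ k h))

module _ {n n⁰ n¹ : ℕ} where

  double-< : ∀ {j} → Halves n n⁰ n¹ → j < n⁰ → double j < n
  double-< (even k) j<k       = ℕₚ.<⇒≤ (double-mono-≤ j<k)
  double-< (odd k)  (s≤s j≤k) = s≤s (double-mono-≤ j≤k)

  suc-double-< : ∀ {j} → Halves n n⁰ n¹ → j < n¹ → suc (double j) < n
  suc-double-< (even k) j<k = double-mono-≤ j<k
  suc-double-< (odd k)  j<k = s≤s (ℕₚ.<⇒≤ (double-mono-≤ j<k))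

  double-<⁻¹ : ∀ {j} → Halves n n⁰ n¹ → double j < n → j < n⁰
  double-<⁻¹ (even k) 2j<2k       = double-cancel-< 2j<2k
  double-<⁻¹ (odd k)  (s≤s 2j≤2k) = s≤s (double-cancel-≤ 2j≤2k)

  suc-double-<⁻¹ : ∀ {j} → Halves n n⁰ n¹ → suc (double j) < n → j < n¹
  suc-double-<⁻¹ (even k) 2j+1<2k       = double-cancel-≤ 2j+1<2k
  suc-double-<⁻¹ (odd k)  (s≤s 2j+1≤2k) = double-cancel-< 2j+1≤2k

  halves⁰-≤ : ∀ {s} → Halves n n⁰ n¹ → n ≤ 2 ℕ.* s → n⁰ ≤ s
  halves⁰-≤ {s} (even k) 2k≤2s =
    double-cancel-≤ (subst (double k ≤_) (sym (double≡2* s)) 2k≤2s)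
  halves⁰-≤ {s} (odd k) 2k+1≤2s =
    double-cancel-< (subst (suc (double k) ≤_) (sym (double≡2* s)) 2k+1≤2s)

  halves¹-≤ : ∀ {s} → Halves n n⁰ n¹ → n ≤ 2 ℕ.* s → n¹ ≤ s
  halves¹-≤ h@(even k) n≤2s = halves⁰-≤ h n≤2s
  halves¹-≤ h@(odd k)  n≤2s = ℕₚ.<⇒≤ (halves⁰-≤ h n≤2s)

n≤2^n : ∀ n → n ≤ 2 ℕ.^ n
n≤2^n zero    = z≤n
n≤2^n (suc n) = ℕₚ.+-mono-≤ (ℕₚ.m^n>0 2 n) (ℕₚ.≤-trans (n≤2^n n) (ℕₚ.m≤m+n _ 0))

binary-induction : ∀ {P : ℕ → Set} → P 0 → (∀ k → P k → P (double k)) →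
                   (∀ k → P k → P (suc (double k))) → ∀ n → P n
binary-induction {P} P0 P-double P-suc-double n = bounded n (n≤2^n n)
  where
  bounded : ∀ f {n} → n ≤ 2 ℕ.^ f → P n
  bounded zero    {zero}        _       = P0
  bounded zero    {suc zero}    _       = P-suc-double 0 P0
  bounded zero    {suc (suc _)} (s≤s ())
  bounded (suc f) {n}           n≤2ᶠ⁺¹ with halves n
  ... | _ , _ , h@(even k) = P-double k (bounded f (halves¹-≤ h n≤2ᶠ⁺¹))
  ... | _ , _ , h@(odd k)  = P-suc-double k (bounded f (halves¹-≤ h n≤2ᶠ⁺¹))

parity-C-pascal : ∀ n k → parity (suc n C suc k) ≡ parity (n C k) ℙ.+ parity (n C suc k)
parity-C-pascal n k =
  trans (cong parity (sym (nCk+nC[k+1]≡[n+1]C[k+1] n k))) (ℙₚ.+-homo-+ (n C k) (n C suc k))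

parity-C-even-even : ∀ j i → parity (double j C double i) ≡ parity (j C i)
parity-C-even-odd  : ∀ j i → parity (double j C suc (double i)) ≡ 0ℙ
parity-C-odd-even  : ∀ j i → parity (suc (double j) C double i) ≡ parity (j C i)
parity-C-odd-odd   : ∀ j i → parity (suc (double j) C suc (double i)) ≡ parity (j C i)

parity-C-even-even j       zero    = refl
parity-C-even-even zero    (suc i) = refl
parity-C-even-even (suc j) (suc i) = begin
  parity (double (suc j) C double (suc i))
    ≡⟨ parity-C-pascal (suc (double j)) (suc (double i)) ⟩
  parity (suc (double j) C suc (double i)) ℙ.+ parity (suc (double j) C double (suc i))
    ≡⟨ cong₂ ℙ._+_ (parity-C-odd-odd j i) (parity-C-odd-even j (suc i)) ⟩
  parity (j C i) ℙ.+ parity (j C suc i)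
    ≡⟨ parity-C-pascal j i ⟨
  parity (suc j C suc i) ∎
  where open ≡-Reasoning

parity-C-even-odd zero    i = refl
parity-C-even-odd (suc j) i = begin
  parity (double (suc j) C suc (double i))
    ≡⟨ parity-C-pascal (suc (double j)) (double i) ⟩
  parity (suc (double j) C double i) ℙ.+ parity (suc (double j) C suc (double i))
    ≡⟨ cong₂ ℙ._+_ (parity-C-odd-even j i) (parity-C-odd-odd j i) ⟩
  parity (j C i) ℙ.+ parity (j C i)
    ≡⟨ ℙₚ.p+p≡0ℙ (parity (j C i)) ⟩
  0ℙ ∎
  where open ≡-Reasoning

parity-C-odd-even j zero    = refl
parity-C-odd-even j (suc i) = trans (parity-C-pascal (double j) (suc (double i)))
  (cong₂ ℙ._+_ (parity-C-even-odd j i) (parity-C-even-even j (suc i)))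

parity-C-odd-odd j i = begin
  parity (suc (double j) C suc (double i))
    ≡⟨ parity-C-pascal (double j) (double i) ⟩
  parity (double j C double i) ℙ.+ parity (double j C suc (double i))
    ≡⟨ cong₂ ℙ._+_ (parity-C-even-even j i) (parity-C-even-odd j i) ⟩
  parity (j C i) ℙ.+ 0ℙ
    ≡⟨ ℙₚ.+-identityʳ (parity (j C i)) ⟩
  parity (j C i) ∎
  where open ≡-Reasoning

%2-cong-parity : ∀ m n → parity m ≡ parity n → m % 2 ≡ n % 2
%2-cong-parity zero          zero          _  = refl
%2-cong-parity zero          (suc zero)    ()
%2-cong-parity zero          (suc (suc n)) eq = %2-cong-parity zero n eq
%2-cong-parity (suc zero)    zero          ()
%2-cong-parity (suc zero)    (suc zero)    _  = refl
%2-cong-parity (suc zero)    (suc (suc n)) eq = %2-cong-parity 1 n eq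
%2-cong-parity (suc (suc m)) n             eq = %2-cong-parity m n eq

binomMod2-cong : ∀ j i j′ i′ → parity (j C i) ≡ parity (j′ C i′) → binomMod2 j i ≡ binomMod2 j′ i′
binomMod2-cong j i j′ i′ eq = cong +_ (%2-cong-parity (j C i) (j′ C i′) eq)

binomMod2-even : ∀ j i → parity (j C i) ≡ 0ℙ → binomMod2 j i ≡ + 0
binomMod2-even j i eq = cong +_ (%2-cong-parity (j C i) 0 eq)

binomMod2-odd : ∀ j i → parity (j C i) ≡ 1ℙ → binomMod2 j i ≡ + 1
binomMod2-odd j i eq = cong +_ (%2-cong-parity (j C i) 1 eq)

[1+n]/2≤n : ∀ n → suc n / 2 ≤ n
[1+n]/2≤n n = ℕₚ.≤-pred (m/n<m (suc n) 2 (ℕₚ.n<1+n 1))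

[2+n]/2≡1+n/2 : ∀ n → suc (suc n) / 2 ≡ suc (n / 2)
[2+n]/2≡1+n/2 n = m/n≡1+[m∸n]/n {suc (suc n)} (s≤s (s≤s z≤n))

double-%2 : ∀ k → double k % 2 ≡ 0
double-%2 zero    = refl
double-%2 (suc k) = double-%2 k

suc-double-%2 : ∀ k → suc (double k) % 2 ≡ 1
suc-double-%2 zero    = refl
suc-double-%2 (suc k) = suc-double-%2 k

double-/2 : ∀ k → double k / 2 ≡ k
double-/2 zero    = refl
double-/2 (suc k) = trans ([2+n]/2≡1+n/2 (double k)) (cong suc (double-/2 k))

suc-double-/2 : ∀ k → suc (double k) / 2 ≡ k
suc-double-/2 zero    = refl
suc-double-/2 (suc k) = trans ([2+n]/2≡1+n/2 (suc (double k))) (cong suc (suc-double-/2 k))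

s₂-fuel-irrelevant : ∀ {f g n} → n ≤ f → n ≤ g → s₂-fuel f n ≡ s₂-fuel g n
s₂-fuel-irrelevant {zero}  {zero}  {zero}  _         _         = refl
s₂-fuel-irrelevant {zero}  {suc g} {zero}  _         _         = refl
s₂-fuel-irrelevant {suc f} {zero}  {zero}  _         _         = refl
s₂-fuel-irrelevant {suc f} {suc g} {zero}  _         _         = refl
s₂-fuel-irrelevant {suc f} {suc g} {suc n} (s≤s n≤f) (s≤s n≤g) = cong (suc n % 2 ℕ.+_)
  (s₂-fuel-irrelevant (ℕₚ.≤-trans ([1+n]/2≤n n) n≤f) (ℕₚ.≤-trans ([1+n]/2≤n n) n≤g))

s₂-suc : ∀ n → s₂ (suc n) ≡ suc n % 2 ℕ.+ s₂ (suc n / 2)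
s₂-suc n = cong (suc n % 2 ℕ.+_) (s₂-fuel-irrelevant ([1+n]/2≤n n) ℕₚ.≤-refl)

s₂-double : ∀ k → s₂ (double k) ≡ s₂ k
s₂-double zero    = refl
s₂-double (suc k) = trans (s₂-suc (suc (double k)))
  (cong₂ ℕ._+_ (double-%2 (suc k)) (cong s₂ (double-/2 (suc k))))

s₂-suc-double : ∀ k → s₂ (suc (double k)) ≡ suc (s₂ k)
s₂-suc-double k = trans (s₂-suc (double k))
  (cong₂ ℕ._+_ (suc-double-%2 k) (cong s₂ (suc-double-/2 k)))

-- The binary digits of i are among those of j (Lucas), so i has at most as many of them.
s₂-mono : ∀ j i → parity (j C i) ≡ 1ℙ → s₂ i ≤ s₂ j
s₂-mono = binary-induction base step-double step-suc-double
  where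
  base : ∀ i → parity (0 C i) ≡ 1ℙ → s₂ i ≤ s₂ 0
  base zero    _  = z≤n
  base (suc i) ()

  step-double : ∀ k → (∀ i → parity (k C i) ≡ 1ℙ → s₂ i ≤ s₂ k) →
                ∀ i → parity (double k C i) ≡ 1ℙ → s₂ i ≤ s₂ (double k)
  step-double k ih i C-odd with halves i
  ... | _ , _ , even l rewrite s₂-double l | s₂-double k =
    ih l (trans (sym (parity-C-even-even k l)) C-odd)
  ... | _ , _ , odd l = contradiction (trans (sym (parity-C-even-odd k l)) C-odd) λ ()

  step-suc-double : ∀ k → (∀ i → parity (k C i) ≡ 1ℙ → s₂ i ≤ s₂ k) →
                    ∀ i → parity (suc (double k) C i) ≡ 1ℙ → s₂ i ≤ s₂ (suc (double k))
  step-suc-double k ih i C-odd with halves i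
  ... | _ , _ , even l rewrite s₂-double l | s₂-suc-double k =
    ℕₚ.m≤n⇒m≤1+n (ih l (trans (sym (parity-C-odd-even k l)) C-odd))
  ... | _ , _ , odd l rewrite s₂-suc-double l | s₂-suc-double k =
    s≤s (ih l (trans (sym (parity-C-odd-odd k l)) C-odd))

module _ where
  open import Data.Integer.Base using (_+_; _*_; _-_; _^_)

  ∑ : ℕ → (ℕ → ℤ) → ℤ
  ∑ n f = Σ n (f ∘ toℕ)

  Σ-cong : ∀ n {f g : Fin n → ℤ} → (∀ i → f i ≡ g i) → Σ n f ≡ Σ n g
  Σ-cong zero    _   = refl
  Σ-cong (suc n) f≗g = cong₂ _+_ (f≗g Fin.zero) (Σ-cong n (f≗g ∘ Fin.suc))

  ∑-cong : ∀ n {f g : ℕ → ℤ} → (∀ i → i < n → f i ≡ g i) → ∑ n f ≡ ∑ n g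
  ∑-cong n f≗g = Σ-cong n (λ i → f≗g (toℕ i) (Finₚ.toℕ<n i))

  ∑-zero : ∀ n → ∑ n (λ _ → + 0) ≡ + 0
  ∑-zero zero    = refl
  ∑-zero (suc n) = trans (ℤₚ.+-identityˡ _) (∑-zero n)

  ∑-last : ∀ n f → ∑ (suc n) f ≡ ∑ n f + f n
  ∑-last zero    f = trans (ℤₚ.+-identityʳ (f 0)) (sym (ℤₚ.+-identityˡ (f 0)))
  ∑-last (suc n) f =
    trans (cong (λ s → f 0 + s) (∑-last n (f ∘ suc))) (sym (ℤₚ.+-assoc (f 0) _ _))

  ∑-*ˡ : ∀ n x f → ∑ n (λ i → x * f i) ≡ x * ∑ n f
  ∑-*ˡ zero    x f = sym (ℤₚ.*-zeroʳ x)
  ∑-*ˡ (suc n) x f =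
    trans (cong (λ s → x * f 0 + s) (∑-*ˡ n x (f ∘ suc))) (sym (ℤₚ.*-distribˡ-+ x (f 0) _))

  ∑-distrib-+ : ∀ n f g → ∑ n (λ i → f i + g i) ≡ ∑ n f + ∑ n g
  ∑-distrib-+ zero    f g = refl
  ∑-distrib-+ (suc n) f g = trans (cong (λ s → f 0 + g 0 + s) (∑-distrib-+ n (f ∘ suc) (g ∘ suc)))
                                  (interchange (f 0) (g 0) _ _)
    where
    interchange : ∀ w x y z → (w + x) + (y + z) ≡ (w + y) + (x + z)
    interchange = solve-∀

  ∑-halves : ∀ {n n⁰ n¹} → Halves n n⁰ n¹ → ∀ f →
             ∑ n f ≡ ∑ n⁰ (f ∘ double) + ∑ n¹ (f ∘ suc ∘ double)
  ∑-halves (even zero)    f = refl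
  ∑-halves (even (suc k)) f = begin
    f 0 + (f 1 + ∑ (double k) (f ∘ suc ∘ suc))
      ≡⟨ cong (λ s → f 0 + (f 1 + s)) (∑-halves (even k) (f ∘ suc ∘ suc)) ⟩
    f 0 + (f 1 + (∑ k (f ∘ double ∘ suc) + ∑ k (f ∘ suc ∘ double ∘ suc)))
      ≡⟨ shuffle (f 0) (f 1) _ _ ⟩
    (f 0 + ∑ k (f ∘ double ∘ suc)) + (f 1 + ∑ k (f ∘ suc ∘ double ∘ suc)) ∎
    where
    open ≡-Reasoning
    shuffle : ∀ w x y z → w + (x + (y + z)) ≡ (w + y) + (x + z)
    shuffle = solve-∀
  ∑-halves (odd k) f = begin
    f 0 + ∑ (double k) (f ∘ suc)
      ≡⟨ cong (λ s → f 0 + s) (∑-halves (even k) (f ∘ suc)) ⟩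
    f 0 + (∑ k (f ∘ suc ∘ double) + ∑ k (f ∘ double ∘ suc))
      ≡⟨ shuffle (f 0) _ _ ⟩
    (f 0 + ∑ k (f ∘ double ∘ suc)) + ∑ k (f ∘ suc ∘ double) ∎
    where
    open ≡-Reasoning
    shuffle : ∀ x y z → x + (y + z) ≡ (x + z) + y
    shuffle = solve-∀

  ZeroModBelow : ℕ → ℕ → (ℕ → ℤ) → Set
  ZeroModBelow p n f = ∀ i → i < n → + p ∣ f i

  module _ {p : ℕ} where

    ZeroModBelow-suc : ∀ {n f} → ZeroModBelow p n f → + p ∣ f n → ZeroModBelow p (suc n) f
    ZeroModBelow-suc zeros p∣fn i (s≤s i≤n) with ℕₚ.m≤n⇒m<n∨m≡n i≤n
    ... | inj₁ i<n  = zeros i i<n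
    ... | inj₂ refl = p∣fn

    ZeroModBelow-+ : ∀ m {n f} → ZeroModBelow p m f → ZeroModBelow p n (f ∘ (m ℕ.+_)) →
                     ZeroModBelow p (m ℕ.+ n) f
    ZeroModBelow-+ zero    _     zeros′ = zeros′
    ZeroModBelow-+ (suc m) zeros _      zero    _           = zeros zero (s≤s z≤n)
    ZeroModBelow-+ (suc m) zeros zeros′ (suc i) (s≤s i<m+n) =
      ZeroModBelow-+ m (λ j j<m → zeros (suc j) (s≤s j<m)) zeros′ i i<m+n

    ZeroModBelow-halves : ∀ {n n⁰ n¹ f} → Halves n n⁰ n¹ →
      ZeroModBelow p n⁰ (f ∘ double) → ZeroModBelow p n¹ (f ∘ suc ∘ double) → ZeroModBelow p n f
    ZeroModBelow-halves h zeros⁰ zeros¹ i i<n with halves i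
    ... | _ , _ , even l = zeros⁰ l (double-<⁻¹ h i<n)
    ... | _ , _ , odd l  = zeros¹ l (suc-double-<⁻¹ h i<n)

    ∑-∣ : ∀ n {f} → ZeroModBelow p n f → + p ∣ ∑ n f
    ∑-∣ zero    _     = divides (+ 0) refl
    ∑-∣ (suc n) zeros =
      ∣m∣n⇒∣m+n (zeros 0 (s≤s z≤n)) (∑-∣ n (λ i i<n → zeros (suc i) (s≤s i<n)))

    ∣-drop-multiples : ∀ a b {x y u v} → + p ∣ (a * x + y) + (b * u + v) → + p ∣ x → + p ∣ u →
                       + p ∣ y + v
    ∣-drop-multiples a b {x} {y} {u} {v} p∣sum p∣x p∣u = ∣m+n∣m⇒∣n
      (subst (+ p ∣_) (regroup a b x y u v) p∣sum) (∣m∣n⇒∣m+n (∣n⇒∣m*n a p∣x) (∣n⇒∣m*n b p∣u))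
      where
      regroup : ∀ a b x y u v → (a * x + y) + (b * u + v) ≡ (a * x + b * u) + (y + v)
      regroup = solve-∀

    ∣-eliminate : ∀ a b {x y u v} → + p ∣ (a * x + y) + (b * u + v) → + p ∣ x + u →
                  + p ∣ ((a - b) * x + y) + v
    ∣-eliminate a b {x} {y} {u} {v} p∣sum p∣x+u =
      subst (+ p ∣_) (cancel a b x y u v) (∣m∣n⇒∣m-n p∣sum (∣n⇒∣m*n b p∣x+u))
      where
      cancel : ∀ a b x y u v → ((a * x + y) + (b * u + v)) - b * (x + u) ≡ ((a - b) * x + y) + v
      cancel = solve-∀

    ∣-drop-middle : ∀ {x t u} → + p ∣ (x + t) + u → + p ∣ t → + p ∣ x + u
    ∣-drop-middle {x} {t} {u} p∣sum p∣t = ∣m+n∣m⇒∣n (subst (+ p ∣_) (regroup x t u) p∣sum) p∣t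
      where
      regroup : ∀ x t u → (x + t) + u ≡ t + (x + u)
      regroup = solve-∀

  prime-∣-cancelˡ : ∀ {p} → Prime p → ∀ {x y} → ¬ (+ p ∣ x) → + p ∣ x * y → + p ∣ y
  prime-∣-cancelˡ {p} p-prime {x} {y} p∤x p∣xy
    with euclidsLemma ℤ.∣ x ∣ ℤ.∣ y ∣ p-prime
                      (subst (ℕ∣._∣_ p) (ℤₚ.abs-* x y) (∣⇒∣ᵤ {+ p} {x * y} p∣xy))
  ... | inj₁ p∣x = contradiction (∣ᵤ⇒∣ p∣x) p∤x
  ... | inj₂ p∣y = ∣ᵤ⇒∣ p∣y

  truncate : ℕ → (ℕ → ℤ) → ℕ → ℤ
  truncate k f i = if does (i ℕₚ.<? k) then f i else + 0

  truncate-< : ∀ {k f i} → i < k → truncate k f i ≡ f i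
  truncate-< {k} {f} {i} i<k rewrite dec-true (i ℕₚ.<? k) i<k = refl

  truncate-self : ∀ k f → truncate k f k ≡ + 0
  truncate-self k f rewrite dec-false (k ℕₚ.<? k) (ℕₚ.<-irrefl refl) = refl

  rowComb : (ℕ → ℕ → ℤ) → ℕ → (ℕ → ℤ) → ℕ → ℤ
  rowComb M d c j = ∑ d (λ i → c i * M i j)

  module _ (M : ℕ → ℕ → ℤ) where

    rowComb-∣ : ∀ {p d c} j → ZeroModBelow p d c → + p ∣ rowComb M d c j
    rowComb-∣ {d = d} j zeros = ∑-∣ d (λ i i<d → ∣m⇒∣m*n (M i j) (zeros i i<d))

    rowComb-linear-truncate : ∀ k x f g j →
      rowComb M (suc k) (λ i → x * f i + truncate k g i) j ≡ x * rowComb M (suc k) f j + rowComb M k g j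
    rowComb-linear-truncate k x f g j = begin
      ∑ (suc k) (λ i → (x * f i + truncate k g i) * M i j)
        ≡⟨ ∑-cong (suc k) (λ i _ → distrib x (f i) (truncate k g i) (M i j)) ⟩
      ∑ (suc k) (λ i → x * (f i * M i j) + truncate k g i * M i j)
        ≡⟨ ∑-distrib-+ (suc k) (λ i → x * (f i * M i j)) (λ i → truncate k g i * M i j) ⟩
      ∑ (suc k) (λ i → x * (f i * M i j)) + rowComb M (suc k) (truncate k g) j
        ≡⟨ cong₂ _+_ (∑-*ˡ (suc k) x (λ i → f i * M i j)) (∑-last k (λ i → truncate k g i * M i j)) ⟩
      x * rowComb M (suc k) f j + (rowComb M k (truncate k g) j + truncate k g k * M k j)
        ≡⟨ cong (λ s → x * rowComb M (suc k) f j + s) (trans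
             (cong₂ _+_ (∑-cong k (λ i i<k → cong (_* M i j) (truncate-< {f = g} i<k)))
                        (cong (_* M k j) (truncate-self k g)))
             (ℤₚ.+-identityʳ _)) ⟩
      x * rowComb M (suc k) f j + rowComb M k g j ∎
      where
      open ≡-Reasoning
      distrib : ∀ x y z m → (x * y + z) * m ≡ x * (y * m) + z * m
      distrib = solve-∀

  -- The infinite Kronecker power of the matrix (1 a; 0 1), read through the binary digits of
  -- the row and the column index.
  record IsKroneckerPower (a : ℤ) (M : ℕ → ℕ → ℤ) : Set where
    field
      corner    : M 0 0 ≡ + 1
      even-even : ∀ i j → M (double i) (double j) ≡ M i j
      even-odd  : ∀ i j → M (double i) (suc (double j)) ≡ a * M i j
      odd-even  : ∀ i j → M (suc (double i)) (double j) ≡ + 0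
      odd-odd   : ∀ i j → M (suc (double i)) (suc (double j)) ≡ M i j

  binomialMatrix : ℤ → ℕ → ℕ → ℤ
  binomialMatrix a i j = binomMod2 j i * a ^ (s₂ j ∸ s₂ i)

  binomialMatrix-even-odd : ∀ a i j →
    binomialMatrix a (double i) (suc (double j)) ≡ a * binomialMatrix a i j
  binomialMatrix-even-odd a i j with parity (j C i) in C-parity
  ... | 0ℙ = begin
    binomMod2 (suc (double j)) (double i) * a ^ (s₂ (suc (double j)) ∸ s₂ (double i))
      ≡⟨ cong (_* a ^ (s₂ (suc (double j)) ∸ s₂ (double i)))
              (binomMod2-even (suc (double j)) (double i) (trans (parity-C-odd-even j i) C-parity)) ⟩
    + 0
      ≡⟨ ℤₚ.*-zeroʳ a ⟨
    a * + 0
      ≡⟨ cong (λ x → a * (x * a ^ (s₂ j ∸ s₂ i))) (binomMod2-even j i C-parity) ⟨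
    a * binomialMatrix a i j ∎
    where open ≡-Reasoning
  ... | 1ℙ = begin
    binomMod2 (suc (double j)) (double i) * a ^ (s₂ (suc (double j)) ∸ s₂ (double i))
      ≡⟨ cong₂ _*_ (binomMod2-odd (suc (double j)) (double i) (trans (parity-C-odd-even j i) C-parity))
                   (cong (a ^_) exponent) ⟩
    + 1 * (a * a ^ (s₂ j ∸ s₂ i))
      ≡⟨ ℤₚ.*-identityˡ _ ⟩
    a * a ^ (s₂ j ∸ s₂ i)
      ≡⟨ cong (a *_) (ℤₚ.*-identityˡ _) ⟨
    a * (+ 1 * a ^ (s₂ j ∸ s₂ i))
      ≡⟨ cong (λ x → a * (x * a ^ (s₂ j ∸ s₂ i))) (binomMod2-odd j i C-parity) ⟨
    a * binomialMatrix a i j ∎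
    where
    open ≡-Reasoning
    exponent : s₂ (suc (double j)) ∸ s₂ (double i) ≡ suc (s₂ j ∸ s₂ i)
    exponent = trans (cong₂ _∸_ (s₂-suc-double j) (s₂-double i))
                     (ℕₚ.+-∸-assoc 1 (s₂-mono j i C-parity))

  binomialMatrix-isKroneckerPower : ∀ a → IsKroneckerPower a (binomialMatrix a)
  binomialMatrix-isKroneckerPower a = record
    { corner    = refl
    ; even-even = λ i j →
        cong₂ _*_ (binomMod2-cong (double j) (double i) j i (parity-C-even-even j i))
                  (cong (a ^_) (cong₂ _∸_ (s₂-double j) (s₂-double i)))
    ; even-odd  = binomialMatrix-even-odd a
    ; odd-even  = λ i j →
        cong (_* a ^ (s₂ (double j) ∸ s₂ (suc (double i))))
             (binomMod2-even (double j) (suc (double i)) (parity-C-even-odd j i))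
    ; odd-odd   = λ i j →
        cong₂ _*_ (binomMod2-cong (suc (double j)) (suc (double i)) j i (parity-C-odd-odd j i))
                  (cong (a ^_) (cong₂ _∸_ (s₂-suc-double j) (s₂-suc-double i)))
    }

  double-≡ᵇ-double : ∀ i j → (double i ≡ᵇ double j) ≡ (i ≡ᵇ j)
  double-≡ᵇ-double zero    zero    = refl
  double-≡ᵇ-double zero    (suc j) = refl
  double-≡ᵇ-double (suc i) zero    = refl
  double-≡ᵇ-double (suc i) (suc j) = double-≡ᵇ-double i j

  double-≡ᵇ-suc-double : ∀ i j → (double i ≡ᵇ suc (double j)) ≡ false
  double-≡ᵇ-suc-double zero    j       = refl
  double-≡ᵇ-suc-double (suc i) zero    = refl
  double-≡ᵇ-suc-double (suc i) (suc j) = double-≡ᵇ-suc-double i j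

  suc-double-≡ᵇ-double : ∀ i j → (suc (double i) ≡ᵇ double j) ≡ false
  suc-double-≡ᵇ-double i       zero    = refl
  suc-double-≡ᵇ-double zero    (suc j) = refl
  suc-double-≡ᵇ-double (suc i) (suc j) = suc-double-≡ᵇ-double i j

  identity-isKroneckerPower : IsKroneckerPower (+ 0) (M₁ (+ 0))
  identity-isKroneckerPower = record
    { corner    = refl
    ; even-even = λ i j → cong δ (double-≡ᵇ-double i j)
    ; even-odd  = λ i j → cong δ (double-≡ᵇ-suc-double i j)
    ; odd-even  = λ i j → cong δ (suc-double-≡ᵇ-double i j)
    ; odd-odd   = λ i j → cong δ (double-≡ᵇ-double i j)
    }
    where
    δ : Bool → ℤ
    δ b = if b then + 1 else + 0

  M₁-isKroneckerPower : ∀ a → IsKroneckerPower a (M₁ a)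
  M₁-isKroneckerPower (+ zero)     = identity-isKroneckerPower
  M₁-isKroneckerPower a@(+ suc _)  = binomialMatrix-isKroneckerPower a
  M₁-isKroneckerPower a@(-[1+ _ ]) = binomialMatrix-isKroneckerPower a

  module _ {a : ℤ} {M : ℕ → ℕ → ℤ} (M-kp : IsKroneckerPower a M) where
    open IsKroneckerPower M-kp

    rowComb-corner : ∀ c → rowComb M 1 c 0 ≡ c 0
    rowComb-corner c =
      trans (ℤₚ.+-identityʳ _) (trans (cong (c 0 *_) corner) (ℤₚ.*-identityʳ (c 0)))

    rowComb-even-column : ∀ {d d⁰ d¹} → Halves d d⁰ d¹ → ∀ c j →
      rowComb M d c (double j) ≡ rowComb M d⁰ (c ∘ double) j
    rowComb-even-column {d} {d⁰} {d¹} h c j = begin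
      rowComb M d c (double j)
        ≡⟨ ∑-halves h (λ i → c i * M i (double j)) ⟩
      ∑ d⁰ (λ i → c (double i) * M (double i) (double j))
        + ∑ d¹ (λ i → c (suc (double i)) * M (suc (double i)) (double j))
        ≡⟨ cong₂ _+_ (∑-cong d⁰ (λ i _ → cong (c (double i) *_) (even-even i j)))
                     (∑-cong d¹ (λ i _ → trans (cong (c (suc (double i)) *_) (odd-even i j))
                                               (ℤₚ.*-zeroʳ (c (suc (double i)))))) ⟩
      rowComb M d⁰ (c ∘ double) j + ∑ d¹ (λ _ → + 0)
        ≡⟨ cong (λ s → rowComb M d⁰ (c ∘ double) j + s) (∑-zero d¹) ⟩
      rowComb M d⁰ (c ∘ double) j + + 0
        ≡⟨ ℤₚ.+-identityʳ _ ⟩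
      rowComb M d⁰ (c ∘ double) j ∎
      where open ≡-Reasoning

    rowComb-odd-column : ∀ {d d⁰ d¹} → Halves d d⁰ d¹ → ∀ c j →
      rowComb M d c (suc (double j))
        ≡ a * rowComb M d⁰ (c ∘ double) j + rowComb M d¹ (c ∘ suc ∘ double) j
    rowComb-odd-column {d} {d⁰} {d¹} h c j = begin
      rowComb M d c (suc (double j))
        ≡⟨ ∑-halves h (λ i → c i * M i (suc (double j))) ⟩
      ∑ d⁰ (λ i → c (double i) * M (double i) (suc (double j)))
        + ∑ d¹ (λ i → c (suc (double i)) * M (suc (double i)) (suc (double j)))
        ≡⟨ cong₂ _+_ (∑-cong d⁰ (λ i _ → trans (cong (c (double i) *_) (even-odd i j))
                                               (swap (c (double i)) a (M i j))))
                     (∑-cong d¹ (λ i _ → cong (c (suc (double i)) *_) (odd-odd i j))) ⟩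
      ∑ d⁰ (λ i → a * (c (double i) * M i j)) + rowComb M d¹ (c ∘ suc ∘ double) j
        ≡⟨ cong (_+ rowComb M d¹ (c ∘ suc ∘ double) j) (∑-*ˡ d⁰ a (λ i → c (double i) * M i j)) ⟩
      a * rowComb M d⁰ (c ∘ double) j + rowComb M d¹ (c ∘ suc ∘ double) j ∎
      where
      open ≡-Reasoning
      swap : ∀ x y z → x * (y * z) ≡ y * (x * z)
      swap = solve-∀

  IndependentRows : ℕ → (M N : ℕ → ℕ → ℤ) → ℕ → ℕ → Set
  IndependentRows p M N d₁ d₂ = ∀ c e →
    ZeroModBelow p (d₁ ℕ.+ d₂) (λ j → rowComb M d₁ c j + rowComb N d₂ e j) →
    ZeroModBelow p d₁ c × ZeroModBelow p d₂ e

  module _ {a b : ℤ} {M N : ℕ → ℕ → ℤ} (M-kp : IsKroneckerPower a M) (N-kp : IsKroneckerPower b N)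
           {p : ℕ} where

    module _ {d₁ d₁⁰ d₁¹ d₂ d₂⁰ d₂¹ m m⁰ m¹ : ℕ}
             (h₁ : Halves d₁ d₁⁰ d₁¹) (h₂ : Halves d₂ d₂⁰ d₂¹) (h : Halves m m⁰ m¹) (c e : ℕ → ℤ)
             (zeros : ZeroModBelow p m (λ j → rowComb M d₁ c j + rowComb N d₂ e j)) where

      ZeroModBelow-even-columns :
        ZeroModBelow p m⁰ (λ j → rowComb M d₁⁰ (c ∘ double) j + rowComb N d₂⁰ (e ∘ double) j)
      ZeroModBelow-even-columns j j<m⁰ = subst (+ p ∣_)
        (cong₂ _+_ (rowComb-even-column M-kp h₁ c j) (rowComb-even-column N-kp h₂ e j))
        (zeros (double j) (double-< h j<m⁰))

      ZeroModBelow-odd-columns : ZeroModBelow p m¹ (λ j →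
          (a * rowComb M d₁⁰ (c ∘ double) j + rowComb M d₁¹ (c ∘ suc ∘ double) j)
        + (b * rowComb N d₂⁰ (e ∘ double) j + rowComb N d₂¹ (e ∘ suc ∘ double) j))
      ZeroModBelow-odd-columns j j<m¹ = subst (+ p ∣_)
        (cong₂ _+_ (rowComb-odd-column M-kp h₁ c j) (rowComb-odd-column N-kp h₂ e j))
        (zeros (suc (double j)) (suc-double-< h j<m¹))

    independentRows-1-0 : IndependentRows p M N 1 0
    independentRows-1-0 c e zeros = ZeroModBelow-suc (λ _ ()) p∣c₀ , λ _ ()
      where
      p∣c₀ : + p ∣ c 0
      p∣c₀ = subst (+ p ∣_) (trans (ℤₚ.+-identityʳ _) (rowComb-corner M-kp c)) (zeros 0 (s≤s z≤n))

    independentRows-0-1 : IndependentRows p M N 0 1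
    independentRows-0-1 c e zeros = (λ _ ()) , ZeroModBelow-suc (λ _ ()) p∣e₀
      where
      p∣e₀ : + p ∣ e 0
      p∣e₀ = subst (+ p ∣_) (trans (ℤₚ.+-identityˡ _) (rowComb-corner N-kp e)) (zeros 0 (s≤s z≤n))

    independentRows-halves : ∀ {d₁ d₁⁰ d₁¹ d₂ d₂⁰ d₂¹} → Halves d₁ d₁⁰ d₁¹ → Halves d₂ d₂⁰ d₂¹ →
      Halves (d₁ ℕ.+ d₂) (d₁⁰ ℕ.+ d₂⁰) (d₁¹ ℕ.+ d₂¹) →
      IndependentRows p M N d₁⁰ d₂⁰ → IndependentRows p M N d₁¹ d₂¹ → IndependentRows p M N d₁ d₂
    independentRows-halves {d₁⁰ = d₁⁰} {d₁¹} {d₂⁰ = d₂⁰} {d₂¹} h₁ h₂ h ind⁰ ind¹ c e zeros =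
        ZeroModBelow-halves h₁ (proj₁ evens) (proj₁ odds)
      , ZeroModBelow-halves h₂ (proj₂ evens) (proj₂ odds)
      where
      evens : ZeroModBelow p d₁⁰ (c ∘ double) × ZeroModBelow p d₂⁰ (e ∘ double)
      evens = ind⁰ (c ∘ double) (e ∘ double) (ZeroModBelow-even-columns h₁ h₂ h c e zeros)
      odds : ZeroModBelow p d₁¹ (c ∘ suc ∘ double) × ZeroModBelow p d₂¹ (e ∘ suc ∘ double)
      odds = ind¹ (c ∘ suc ∘ double) (e ∘ suc ∘ double) λ j j< → ∣-drop-multiples a b
        (ZeroModBelow-odd-columns h₁ h₂ h c e zeros j j<)
        (rowComb-∣ M j (proj₁ evens)) (rowComb-∣ N j (proj₂ evens))

    module _ (p-prime : Prime p) (p∤a-b : ¬ (+ p ∣ a - b)) where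

      -- The odd columns minus b times the even ones leave the factor a - b on the last even row of
      -- M, whose coefficient therefore vanishes; then the even columns involve one row less.
      independentRows-odd-odd : ∀ {k₁ k₂} →
        IndependentRows p M N (suc k₁) k₂ → IndependentRows p M N k₁ (suc k₂) →
        IndependentRows p M N (suc (double k₁)) (suc (double k₂))
      independentRows-odd-odd {k₁} {k₂} ind⁰ ind¹ c e zeros =
          ZeroModBelow-halves (odd k₁) c⁰-zero c¹-zero
        , ZeroModBelow-halves (odd k₂) (proj₂ even-step) (proj₂ odd-step)
        where
        h : Halves (suc (double k₁) ℕ.+ suc (double k₂)) (suc (k₁ ℕ.+ k₂)) (k₁ ℕ.+ suc k₂)
        h = Halves-suc (Halves-double-+ k₁ (odd k₂))

        c⁰ c¹ e⁰ e¹ c′ : ℕ → ℤ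
        c⁰ = c ∘ double
        c¹ = c ∘ suc ∘ double
        e⁰ = e ∘ double
        e¹ = e ∘ suc ∘ double
        c′ i = (a - b) * c⁰ i + truncate k₁ c¹ i

        odd-step : ZeroModBelow p (suc k₁) c′ × ZeroModBelow p k₂ e¹
        odd-step = ind⁰ c′ e¹ λ j j< →
          subst (+ p ∣_)
                (cong (_+ rowComb N k₂ e¹ j) (sym (rowComb-linear-truncate M k₁ (a - b) c⁰ c¹ j)))
                (∣-eliminate a b (ZeroModBelow-odd-columns (odd k₁) (odd k₂) h c e zeros j
                                                           (subst (j <_) (sym (ℕₚ.+-suc k₁ k₂)) j<))
                                 (ZeroModBelow-even-columns (odd k₁) (odd k₂) h c e zeros j j<))

        p∣c⁰-last : + p ∣ c⁰ k₁
        p∣c⁰-last = prime-∣-cancelˡ p-prime p∤a-b (subst (+ p ∣_)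
          (trans (cong (λ t → (a - b) * c⁰ k₁ + t) (truncate-self k₁ c¹)) (ℤₚ.+-identityʳ _))
          (proj₁ odd-step k₁ ℕₚ.≤-refl))

        even-step : ZeroModBelow p k₁ c⁰ × ZeroModBelow p (suc k₂) e⁰
        even-step = ind¹ c⁰ e⁰ λ j j< →
          ∣-drop-middle {x = rowComb M k₁ c⁰ j} {u = rowComb N (suc k₂) e⁰ j}
            (subst (+ p ∣_) (cong (_+ rowComb N (suc k₂) e⁰ j) (∑-last k₁ (λ i → c⁰ i * M i j)))
                   (ZeroModBelow-even-columns (odd k₁) (odd k₂) h c e zeros j
                                              (subst (j <_) (ℕₚ.+-suc k₁ k₂) j<)))
            (∣m⇒∣m*n (M k₁ j) p∣c⁰-last)

        c⁰-zero : ZeroModBelow p (suc k₁) c⁰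
        c⁰-zero = ZeroModBelow-suc (proj₁ even-step) p∣c⁰-last

        c¹-zero : ZeroModBelow p k₁ c¹
        c¹-zero i i<k₁ = ∣m+n∣m⇒∣n
          (subst (+ p ∣_) (cong (λ t → (a - b) * c⁰ i + t) (truncate-< {f = c¹} i<k₁))
                 (proj₁ odd-step i (ℕₚ.m<n⇒m<1+n i<k₁)))
          (∣n⇒∣m*n (a - b) (c⁰-zero i (ℕₚ.m<n⇒m<1+n i<k₁)))

      IndependentRowsUpTo : ℕ → Set
      IndependentRowsUpTo s = ∀ {d₁ d₂} → d₁ ℕ.+ d₂ ≤ s → IndependentRows p M N d₁ d₂

      independentRowsUpTo-1 : IndependentRowsUpTo 1
      independentRowsUpTo-1 {zero}        {zero}        _ = λ _ _ _ → (λ _ ()) , (λ _ ())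
      independentRowsUpTo-1 {suc zero}    {zero}        _ = independentRows-1-0
      independentRowsUpTo-1 {zero}        {suc zero}    _ = independentRows-0-1
      independentRowsUpTo-1 {suc (suc _)} {_}           (s≤s ())
      independentRowsUpTo-1 {suc zero}    {suc _}       (s≤s ())
      independentRowsUpTo-1 {zero}        {suc (suc _)} (s≤s ())

      independentRowsUpTo-double : ∀ {s} → IndependentRowsUpTo s → IndependentRowsUpTo (2 ℕ.* s)
      independentRowsUpTo-double ind {d₁} {d₂} bound with halves d₁ | halves d₂
      ... | _ , _ , even k₁ | _ , _ , even k₂ =
        independentRows-halves (even k₁) (even k₂) h (ind (halves⁰-≤ h bound)) (ind (halves¹-≤ h bound))
        where h = Halves-double-+ k₁ (even k₂)
      ... | _ , _ , even k₁ | _ , _ , odd k₂ =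
        independentRows-halves (even k₁) (odd k₂) h (ind (halves⁰-≤ h bound)) (ind (halves¹-≤ h bound))
        where h = Halves-double-+ k₁ (odd k₂)
      ... | _ , _ , odd k₁ | _ , _ , even k₂ =
        independentRows-halves (odd k₁) (even k₂) h (ind (halves⁰-≤ h bound)) (ind (halves¹-≤ h bound))
        where h = Halves-suc (Halves-double-+ k₁ (even k₂))
      ... | _ , _ , odd k₁ | _ , _ , odd k₂ =
        independentRows-odd-odd (ind (halves⁰-≤ h bound)) (ind (halves¹-≤ h bound))
        where h = Halves-suc (Halves-double-+ k₁ (odd k₂))

      independentRowsUpTo : ∀ f → IndependentRowsUpTo (2 ℕ.^ f)
      independentRowsUpTo zero    = independentRowsUpTo-1
      independentRowsUpTo (suc f) = independentRowsUpTo-double (independentRowsUpTo f)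

      independentRows : ∀ d₁ d₂ → IndependentRows p M N d₁ d₂
      independentRows d₁ d₂ = independentRowsUpTo (d₁ ℕ.+ d₂) (n≤2^n (d₁ ℕ.+ d₂))

  extend : ∀ {n} → (Fin n → ℤ) → ℕ → ℤ
  extend {zero}  f _       = + 0
  extend {suc n} f zero    = f Fin.zero
  extend {suc n} f (suc i) = extend (f ∘ Fin.suc) i

  extend-toℕ : ∀ {n} (f : Fin n → ℤ) i → extend f (toℕ i) ≡ f i
  extend-toℕ f Fin.zero    = refl
  extend-toℕ f (Fin.suc i) = extend-toℕ (f ∘ Fin.suc) i

  Σ-++ : ∀ m n (f : Fin (m ℕ.+ n) → ℤ) → Σ (m ℕ.+ n) f ≡ Σ m (f ∘ (_↑ˡ n)) + Σ n (f ∘ (m ↑ʳ_))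
  Σ-++ zero    n f = sym (ℤₚ.+-identityˡ _)
  Σ-++ (suc m) n f =
    trans (cong (λ s → f Fin.zero + s) (Σ-++ m n (f ∘ Fin.suc))) (sym (ℤₚ.+-assoc (f Fin.zero) _ _))

  stackedRows-column : ∀ a b d₁ d₂ (c : Fin (d₁ ℕ.+ d₂) → ℤ) col →
    Σ (d₁ ℕ.+ d₂) (λ r → c r * stackedRows a b d₁ d₂ r col)
      ≡ rowComb (M₁ a) d₁ (extend c) (toℕ col) + rowComb (M₁ b) d₂ (extend c ∘ (d₁ ℕ.+_)) (toℕ col)
  stackedRows-column a b d₁ d₂ c col =
    trans (Σ-++ d₁ d₂ _) (cong₂ _+_ (Σ-cong d₁ upper) (Σ-cong d₂ lower))
    where
    upper : ∀ i → c (i ↑ˡ d₂) * stackedRows a b d₁ d₂ (i ↑ˡ d₂) col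
                    ≡ extend c (toℕ i) * M₁ a (toℕ i) (toℕ col)
    upper i rewrite Finₚ.splitAt-↑ˡ d₁ i d₂ = cong (_* M₁ a (toℕ i) (toℕ col))
      (trans (sym (extend-toℕ c _)) (cong (extend c) (Finₚ.toℕ-↑ˡ i d₂)))
    lower : ∀ i → c (d₁ ↑ʳ i) * stackedRows a b d₁ d₂ (d₁ ↑ʳ i) col
                    ≡ extend c (d₁ ℕ.+ toℕ i) * M₁ b (toℕ i) (toℕ col)
    lower i rewrite Finₚ.splitAt-↑ʳ d₁ d₂ i = cong (_* M₁ b (toℕ i) (toℕ col))
      (trans (sym (extend-toℕ c _)) (cong (extend c) (Finₚ.toℕ-↑ʳ d₁ i)))

  ≡[mod]0⇒∣ : ∀ {p} x → x ≡[mod p ] (+ 0) → + p ∣ x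
  ≡[mod]0⇒∣ {p} x x≡0 = subst (+ p ∣_) (ℤₚ.+-identityʳ x) (∣ᵤ⇒∣ {+ p} {x - + 0} x≡0)

  ∣⇒≡[mod]0 : ∀ {p} x → + p ∣ x → x ≡[mod p ] (+ 0)
  ∣⇒≡[mod]0 {p} x p∣x = ∣⇒∣ᵤ {+ p} {x - + 0} (subst (+ p ∣_) (sym (ℤₚ.+-identityʳ x)) p∣x)

  fullRankMod-stackedRows : ∀ {p} a b d₁ d₂ → IndependentRows p (M₁ a) (M₁ b) d₁ d₂ →
                            FullRankMod p (d₁ ℕ.+ d₂) (stackedRows a b d₁ d₂)
  fullRankMod-stackedRows {p} a b d₁ d₂ independent c zeros r = ∣⇒≡[mod]0 (c r)
    (subst (+ p ∣_) (extend-toℕ c r) (ZeroModBelow-+ d₁ (proj₁ coefficients) (proj₂ coefficients)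
                                                     (toℕ r) (Finₚ.toℕ<n r)))
    where
    column : ℕ → ℤ
    column j = rowComb (M₁ a) d₁ (extend c) j + rowComb (M₁ b) d₂ (extend c ∘ (d₁ ℕ.+_)) j
    coefficients : ZeroModBelow p d₁ (extend c) × ZeroModBelow p d₂ (extend c ∘ (d₁ ℕ.+_))
    coefficients = independent (extend c) (extend c ∘ (d₁ ℕ.+_)) λ j j< → subst (+ p ∣_)
      (trans (stackedRows-column a b d₁ d₂ c (fromℕ< j<)) (cong column (Finₚ.toℕ-fromℕ< j<)))
      (≡[mod]0⇒∣ _ (zeros (fromℕ< j<)))

open import Data.Nat.Base using (_+_; _≥_)

corollary3 : (p : ℕ) → Prime p → (a b : ℤ) → ¬ (a ≡[mod p ] b) →
    (d₁ d₂ : ℕ) → d₁ + d₂ ≥ 1 →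
    FullRankMod p (d₁ + d₂) (stackedRows a b d₁ d₂)
corollary3 p p-prime a b a≢b d₁ d₂ _ = fullRankMod-stackedRows a b d₁ d₂
  (independentRows (M₁-isKroneckerPower a) (M₁-isKroneckerPower b) p-prime (a≢b ∘ ∣⇒∣ᵤ) d₁ d₂)
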